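{- For every integer $n\ge 1$, the set of nonnesting permutations of $[n]$ equals $S_n(321)$.
   Context: A nesting of $\sigma\in S_n$ is a pair $(i,j)$ with $i<j<\sigma(j)<\sigma(i)$ or $\sigma(j)<\sigma(i)\le i<j$; $\sigma$ is nonnesting if it has no nesting. $S_n(321)$ is the set of permutations of $[n]$ with no decreasing subsequence of length $3$. -}

module Defs where

open import Data.Nat using (ℕ)
open import Data.Fin using (Fin; _<_; _≤_)
open import Data.Fin.Permutation using (Permutation′; _⟨$⟩ʳ_)
open import Data.Product using (Σ; _×_)
open import Data.Sum using (_⊎_)
open import Relation.Nullary using (¬_)

-- [n] is represented by Fin n = {0,…,n-1} with its usual order
-- (order-isomorphic to {1,…,n}).

IsNesting : {n : ℕ} → Permutation′ n → Fin n → Fin n → Set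
IsNesting σ i j =
  (i < j × j < σ ⟨$⟩ʳ j × σ ⟨$⟩ʳ j < σ ⟨$⟩ʳ i)
  ⊎ (σ ⟨$⟩ʳ j < σ ⟨$⟩ʳ i × σ ⟨$⟩ʳ i ≤ i × i < j)

Nonnesting : {n : ℕ} → Permutation′ n → Set
Nonnesting σ = ∀ i j → ¬ IsNesting σ i j

Contains321 : {n : ℕ} → Permutation′ n → Set
Contains321 {n} σ = Σ (Fin n) λ a → Σ (Fin n) λ b → Σ (Fin n) λ c →
  a < b × b < c × σ ⟨$⟩ʳ c < σ ⟨$⟩ʳ b × σ ⟨$⟩ʳ b < σ ⟨$⟩ʳ a

Avoids321 : {n : ℕ} → Permutation′ n → Set
Avoids321 σ = ¬ Contains321 σ

module Submission where

-- Both directions are proved in the contrapositive, relating nestings to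
-- occurrences of 321:
--   * A 321-occurrence a < b < c, σ(c) < σ(b) < σ(a) yields a nesting:
--     (a , b) if b < σ(b), and (b , c) otherwise.
--   * A nesting yields a 321-occurrence by adding a third index.  This uses
--     one counting fact, the escape lemma: if a permutation π sends some
--     point of the initial segment [0 , u) outside it, then it also sends
--     some point outside [0 , u) into it.  (Otherwise π⁻¹ would restrict to
--     an injective self-map of [0 , u) missing a point, which is impossible.)
--     For an outer nesting i < j < σ(j) < σ(i) the escape lemma for σ at
--     u = j + 1 supplies k > j with σ(k) ≤ j; for an inner nesting
--     σ(j) < σ(i) ≤ i < j the escape lemma for σ⁻¹ at u = i supplies k < i
--     with σ(k) ≥ i.
-- The theorem follows by combining the two translations.

open import Defs
open import Data.Nat using (ℕ; _≥_)
import Data.Nat as ℕ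
open import Data.Nat.Properties using (≤-trans; <-≤-trans; ≤-<-trans; <-irrefl; n<1+n; <⇒≤; <⇒≱; ≰⇒>; ≮⇒≥; 1+n≰n; _<?_; _≤?_)
open import Data.Fin using (Fin; toℕ; fromℕ<; inject≤; punchOut; _<_; _≤_)
open import Data.Fin.Properties
  using (toℕ<n; toℕ-inject≤; inject≤-injective; fromℕ<-injective; toℕ-injective; punchOut-injective; injective⇒≤; any?; ≤∧≢⇒<)
open import Data.Fin.Permutation using (Permutation′; _⟨$⟩ʳ_; _⟨$⟩ˡ_; inverseʳ; inverseˡ; flip)
open import Function.Bundles using (_⇔_; mk⇔)
open import Function.Definitions using (Injective)
open import Data.Product using (∃; _×_; _,_)
open import Data.Sum using (inj₁; inj₂)
open import Relation.Nullary using (¬_; yes; no)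
open import Data.Empty using (⊥-elim)
open import Relation.Nullary.Decidable using (_×-dec_)
open import Relation.Binary.PropositionalEquality using (_≡_; _≢_; sym; trans; cong; subst)

-- An injective self-map of a finite set is surjective: it misses no point.
-- (Removing the missed point would give an injection Fin (1 + m) → Fin m.)
injective-misses-nothing : ∀ {m} (f : Fin m → Fin m) → Injective _≡_ _≡_ f →
                           (p : Fin m) → ¬ (∀ v → f v ≢ p)
injective-misses-nothing {ℕ.suc m} f f-inj p misses =
  1+n≰n (injective⇒≤ {f = f-without-p} f-without-p-inj)
  where
  p≢f : ∀ v → p ≢ f v
  p≢f v p≡fv = misses v (sym p≡fv)

  f-without-p : Fin (ℕ.suc m) → Fin m
  f-without-p v = punchOut (p≢f v)

  f-without-p-inj : Injective _≡_ _≡_ f-without-p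
  f-without-p-inj {v} {w} eq = f-inj (punchOut-injective (p≢f v) (p≢f w) eq)

permutation-injective : ∀ {n} (π : Permutation′ n) {x y : Fin n} →
                        π ⟨$⟩ʳ x ≡ π ⟨$⟩ʳ y → x ≡ y
permutation-injective π {x} {y} eq =
  trans (sym (inverseˡ π)) (trans (cong (π ⟨$⟩ˡ_) eq) (inverseˡ π))

escape : ∀ {n} (π : Permutation′ n) (u : ℕ) (p : Fin n) →
         toℕ p ℕ.< u → u ℕ.≤ toℕ (π ⟨$⟩ʳ p) →
         ∃ λ k → u ℕ.≤ toℕ k × toℕ (π ⟨$⟩ʳ k) ℕ.< u
escape {n} π u p p<u u≤πp
  with any? (λ k → (u ≤? toℕ k) ×-dec (toℕ (π ⟨$⟩ʳ k) <? u))
... | yes found = found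
... | no none = ⊥-elim (injective-misses-nothing q q-injective (restrict p p<u) q-misses-p)
  where
  closed : ∀ k → toℕ (π ⟨$⟩ʳ k) ℕ.< u → toℕ k ℕ.< u
  closed k πk<u = ≰⇒> (λ u≤k → none (k , u≤k , πk<u))

  u≤n : u ℕ.≤ n
  u≤n = <⇒≤ (≤-<-trans u≤πp (toℕ<n (π ⟨$⟩ʳ p)))

  embed : Fin u → Fin n
  embed v = inject≤ v u≤n

  restrict : (k : Fin n) → toℕ k ℕ.< u → Fin u
  restrict k k<u = fromℕ< k<u

  restrict-injective : ∀ {k l} (k<u : toℕ k ℕ.< u) (l<u : toℕ l ℕ.< u) →
                       restrict k k<u ≡ restrict l l<u → k ≡ l
  restrict-injective {k} {l} k<u l<u eq = toℕ-injective (fromℕ<-injective (toℕ k) (toℕ l) k<u l<u eq)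

  π-preimage : ∀ v → π ⟨$⟩ʳ (π ⟨$⟩ˡ embed v) ≡ embed v
  π-preimage v = inverseʳ π

  toℕ-π-embed : ∀ {k} v → π ⟨$⟩ʳ k ≡ embed v → toℕ (π ⟨$⟩ʳ k) ≡ toℕ v
  toℕ-π-embed v πk≡v = trans (cong toℕ πk≡v) (toℕ-inject≤ v u≤n)

  preimage<u : ∀ v → toℕ (π ⟨$⟩ˡ embed v) ℕ.< u
  preimage<u v = closed (π ⟨$⟩ˡ embed v)
    (subst (ℕ._< u) (sym (toℕ-π-embed v (π-preimage v))) (toℕ<n v))

  q : Fin u → Fin u
  q v = restrict (π ⟨$⟩ˡ embed v) (preimage<u v)

  q-injective : Injective _≡_ _≡_ q
  q-injective {v} {w} eq = inject≤-injective u≤n u≤n v w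
    (trans (sym (π-preimage v))
      (trans (cong (π ⟨$⟩ʳ_) (restrict-injective (preimage<u v) (preimage<u w) eq)) (π-preimage w)))

  -- p is not hit, because π sends p outside [0 , u).
  q-misses-p : ∀ v → q v ≢ restrict p p<u
  q-misses-p v eq = <⇒≱ (toℕ<n v) (subst (u ℕ.≤_) (toℕ-π-embed v πp≡v) u≤πp)
    where
    πp≡v : π ⟨$⟩ʳ p ≡ embed v
    πp≡v = trans (cong (π ⟨$⟩ʳ_) (sym (restrict-injective (preimage<u v) p<u eq))) (π-preimage v)

321⇒nesting : ∀ {n} (σ : Permutation′ n) → Contains321 σ → ∃ λ i → ∃ λ j → IsNesting σ i j
321⇒nesting σ (a , b , c , a<b , b<c , σc<σb , σb<σa) with toℕ b <? toℕ (σ ⟨$⟩ʳ b)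
... | yes b<σb = a , b , inj₁ (a<b , b<σb , σb<σa)
... | no  b≮σb = b , c , inj₂ (σc<σb , ≮⇒≥ b≮σb , b<c)

-- An outer nesting i < j < σ(j) < σ(i) extends to a 321-occurrence i < j < k:
-- σ moves j out of [0 , j], so some k > j is moved into [0 , j].
outer-nesting⇒321 : ∀ {n} (σ : Permutation′ n) {i j : Fin n} →
                    i < j → j < σ ⟨$⟩ʳ j → σ ⟨$⟩ʳ j < σ ⟨$⟩ʳ i → Contains321 σ
outer-nesting⇒321 σ {i} {j} i<j j<σj σj<σi
  with escape σ (ℕ.suc (toℕ j)) j (n<1+n (toℕ j)) j<σj
... | k , j<k , σk≤j = i , j , k , i<j , j<k , <-≤-trans σk≤j j<σj , σj<σi

-- An inner nesting σ(j) < σ(i) ≤ i < j extends to a 321-occurrence k < i < j: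
-- σ⁻¹ moves σ(j) out of [0 , i), so some w ≥ i has k = σ⁻¹(w) < i,
-- and then σ(k) = w ≥ i ≥ σ(i), strictly since k ≠ i.
inner-nesting⇒321 : ∀ {n} (σ : Permutation′ n) {i j : Fin n} →
                    σ ⟨$⟩ʳ j < σ ⟨$⟩ʳ i → σ ⟨$⟩ʳ i ≤ i → i < j → Contains321 σ
inner-nesting⇒321 σ {i} {j} σj<σi σi≤i i<j
  with escape (flip σ) (toℕ i) (σ ⟨$⟩ʳ j) (<-≤-trans σj<σi σi≤i)
              (subst (toℕ i ℕ.≤_) (cong toℕ (sym (inverseˡ σ))) (<⇒≤ i<j))
... | w , i≤w , k<i = σ ⟨$⟩ˡ w , i , j , k<i , i<j , σj<σi , σi<σk
  where
  σi≤σk : σ ⟨$⟩ʳ i ≤ σ ⟨$⟩ʳ (σ ⟨$⟩ˡ w)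
  σi≤σk = ≤-trans σi≤i (subst (toℕ i ℕ.≤_) (cong toℕ (sym (inverseʳ σ))) i≤w)

  σi<σk : σ ⟨$⟩ʳ i < σ ⟨$⟩ʳ (σ ⟨$⟩ˡ w)
  σi<σk = ≤∧≢⇒< σi≤σk (λ σi≡σk → <-irrefl (cong toℕ (permutation-injective σ (sym σi≡σk))) k<i)

nesting⇒321 : ∀ {n} (σ : Permutation′ n) {i j : Fin n} → IsNesting σ i j → Contains321 σ
nesting⇒321 σ (inj₁ (i<j , j<σj , σj<σi)) = outer-nesting⇒321 σ i<j j<σj σj<σi
nesting⇒321 σ (inj₂ (σj<σi , σi≤i , i<j)) = inner-nesting⇒321 σ σj<σi σi≤i i<j

-- Lemma 5.1: the nonnesting permutations of [n] are exactly those in S_n(321).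
lemma5p1 : (n : ℕ) → n ≥ 1 → (σ : Permutation′ n) → Nonnesting σ ⇔ Avoids321 σ
lemma5p1 n _ σ = mk⇔ nonnesting⇒avoids avoids⇒nonnesting
  where
  nonnesting⇒avoids : Nonnesting σ → Avoids321 σ
  nonnesting⇒avoids nonnesting occurrence with 321⇒nesting σ occurrence
  ... | i , j , nesting = nonnesting i j nesting

  avoids⇒nonnesting : Avoids321 σ → Nonnesting σ
  avoids⇒nonnesting avoids i j nesting = avoids (nesting⇒321 σ nesting)
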